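{- Let $n$ be a positive integer, let $x$ be a nonzero real or complex number, and let $a_n$ be an integer. Then \[ \left(\frac{x-1}{x}\right)^n\sum_{a_{n-1}=1}^{a_n}\sum_{a_{n-2}=1}^{a_{n-1}}\cdots\sum_{a_0=1}^{a_1}x^{a_0} = x^{a_n}-\sum_{j=0}^{n-1}\left(\frac{x-1}{x}\right)^j\binom{a_n+j-1}{j}. \]
   Context: The left side is an iterated sum with $n$ summation signs: $a_{n-1}$ runs from $1$ to $a_n$, and for each $i$ the index $a_{i-1}$ runs from $1$ to $a_i$. Summation convention: for integers $m,M$, $\sum_{k=m}^{M}h(k)$ is the usual sum if $M\ge m$, equals $0$ if $M=m-1$, and equals $-\sum_{k=M+1}^{m-1}h(k)$ if $M\le m-2$. For an integer $N$ and a non-negative integer $j$, $\binom{N}{j}=N(N-1)\cdots(N-j+1)/j!$. -}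

module Defs where

open import Level using (Level)
open import Algebra.Bundles using (CommutativeRing)
open import Data.Nat as ℕ using (ℕ; zero; suc)
open import Data.Nat.Properties using (_!≢0)
open import Data.Integer as ℤ using (ℤ; +_; -[1+_])
open import Data.Integer.DivMod using (_/ℕ_)

fallingℤ : ℤ → ℕ → ℤ
fallingℤ N zero    = + 1
fallingℤ N (suc j) = fallingℤ N j ℤ.* (N ℤ.- + j)

binomℤ : ℤ → ℕ → ℤ
binomℤ N j = _/ℕ_ (fallingℤ N j) (j ℕ.!) {{j !≢0}}

module _ {c ℓ : Level} (R : CommutativeRing c ℓ) where
  open CommutativeRing R

  pow : Carrier → ℕ → Carrier
  pow z zero    = 1#
  pow z (suc k) = z * pow z k

  natR : ℕ → Carrier
  natR zero    = 0#
  natR (suc k) = 1# + natR k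

  fromℤ : ℤ → Carrier
  fromℤ (+ k)      = natR k
  fromℤ -[1+ k ]   = - natR (suc k)

  sumFrom : ℤ → ℕ → (ℤ → Carrier) → Carrier
  sumFrom m zero    h = 0#
  sumFrom m (suc k) h = h m + sumFrom (m ℤ.+ + 1) k h

  -- Generalized sum Σ_{k=m}^{M} h k with the convention of the paper:
  -- usual sum if M ≥ m, 0 if M = m-1, and - Σ_{k=M+1}^{m-1} h k if M ≤ m-2.
  gsum : ℤ → ℤ → (ℤ → Carrier) → Carrier
  gsum m M h with M ℤ.- m ℤ.+ + 1
  ... | + k      = sumFrom m k h
  ... | -[1+ k ] = - sumFrom (M ℤ.+ + 1) (suc k) h

  sumBelow : ℕ → (ℕ → Carrier) → Carrier
  sumBelow zero    f = 0#
  sumBelow (suc n) f = sumBelow n f + f n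

  module _ (x y : Carrier) where
    -- integer power x^a, where y plays the role of x⁻¹
    zpow : ℤ → Carrier
    zpow (+ k)    = pow x k
    zpow -[1+ k ] = pow y (suc k)

    -- iterSum n a = Σ_{a_{n-1}=1}^{a} Σ_{a_{n-2}=1}^{a_{n-1}} ... Σ_{a_0=1}^{a_1} x^{a_0}
    -- (n summation signs; iterSum 0 a = x^a)
    iterSum : ℕ → ℤ → Carrier
    iterSum zero    a = zpow a
    iterSum (suc n) a = gsum (+ 1) a (λ b → iterSum n b)

{-# OPTIONS --safe #-}
module Submission where

-- Write t = (x - 1)/x, S n a for the iterated sum and C n a for the right-hand side.
-- Viewed as functions of a ∈ ℤ, t ^ (n + 1) * S (n + 1) and C (n + 1) both vanish at a = 0 and
-- have the same increments: S (n + 1) (a + 1) = S (n + 1) a + S n (a + 1) holds for every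
-- integer a thanks to the sign convention for sums, while Pascal's rule together with
-- x ^ (a + 1) = x ^ a + t x ^ (a + 1) gives C (n + 1) (a + 1) = C (n + 1) a + t C n (a + 1).
-- A function on ℤ is determined by its value at 0 and its increments, so induction on n
-- finishes the proof. Pascal's rule for binomℤ comes from identifying N(N-1)⋯(N-j+1)/j! with
-- the coefficients generated by Pascal's rule itself, by the same uniqueness argument.

open import Defs
open import Level using (Level)
open import Algebra.Bundles using (CommutativeRing; Group; AbelianGroup)
open import Data.Nat as ℕ using (ℕ; NonZero; zero; suc; z≤n; s≤s; _!)
import Data.Nat.Properties as ℕₚ
open import Data.Nat.DivMod using (m*n/n≡m; m*n%n≡0)
open import Data.Integer as ℤ using (ℤ; +_; -[1+_])
import Data.Integer.Properties as ℤₚ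
open import Data.Integer.Tactic.RingSolver using (solve-∀)
open import Relation.Binary.PropositionalEquality as ≡ using (_≡_; module ≡-Reasoning)

module _ {a ℓ : Level} (G : Group a ℓ) where
  open Group G
  open import Algebra.Properties.Group G using (∙-cancelʳ)

  equal-increments⇒≈ : (f g d : ℤ → Carrier) →
    (∀ i → f (ℤ.suc i) ≈ f i ∙ d i) → (∀ i → g (ℤ.suc i) ≈ g i ∙ d i) →
    f (+ 0) ≈ g (+ 0) → ∀ i → f i ≈ g i
  equal-increments⇒≈ f g d f-step g-step f0≈g0 = agree
    where
    up : ∀ i → f i ≈ g i → f (ℤ.suc i) ≈ g (ℤ.suc i)
    up i eq = trans (f-step i) (trans (∙-congʳ eq) (sym (g-step i)))

    down : ∀ i → f (ℤ.suc i) ≈ g (ℤ.suc i) → f i ≈ g i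
    down i eq = ∙-cancelʳ (d i) _ _ (trans (sym (f-step i)) (trans eq (g-step i)))

    agree : ∀ i → f i ≈ g i
    agree (+ zero)     = f0≈g0
    agree (+ suc k)    = up (+ k) (agree (+ k))
    agree -[1+ zero ]  = down -[1+ 0 ] f0≈g0
    agree -[1+ suc k ] = down -[1+ suc k ] (agree -[1+ k ])

-- Pascal's rule, read forwards for a nonnegative upper index and backwards for a negative one.
choose : ℤ → ℕ → ℤ
choose N           zero    = + 1
choose (+ zero)    (suc j) = + 0
choose (+ suc m)   (suc j) = choose (+ m) (suc j) ℤ.+ choose (+ m) j
choose -[1+ zero ]  (suc j) = ℤ.- choose -[1+ zero ] j
choose -[1+ suc m ] (suc j) = choose -[1+ m ] (suc j) ℤ.- choose -[1+ suc m ] j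

choose-pascal : ∀ N j → choose (ℤ.suc N) (suc j) ≡ choose N (suc j) ℤ.+ choose N j
choose-pascal (+ m)         j = ≡.refl
choose-pascal -[1+ zero ]   j = ≡.sym (ℤₚ.+-inverseˡ (choose -[1+ 0 ] j))
choose-pascal -[1+ suc m ]  j = a≡a-b+b (choose -[1+ m ] (suc j)) (choose -[1+ suc m ] j)
  where
  a≡a-b+b : ∀ a b → a ≡ a ℤ.- b ℤ.+ b
  a≡a-b+b = solve-∀

choose-vanishes : ∀ {m j} → m ℕ.≤ j → choose (+ m) (suc j) ≡ + 0
choose-vanishes z≤n     = ≡.refl
choose-vanishes (s≤s p) = ≡.cong₂ ℤ._+_ (choose-vanishes (ℕₚ.m≤n⇒m≤1+n p)) (choose-vanishes p)

fallingℤ-shift : ∀ N j → fallingℤ (ℤ.suc N) (suc j) ≡ ℤ.suc N ℤ.* fallingℤ N j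
fallingℤ-shift N zero    = unit (ℤ.suc N)
  where
  unit : ∀ s → + 1 ℤ.* (s ℤ.- + 0) ≡ s ℤ.* + 1
  unit = solve-∀
fallingℤ-shift N (suc j) = begin
  fallingℤ (ℤ.suc N) (suc j) ℤ.* (ℤ.suc N ℤ.- + suc j) ≡⟨ ≡.cong (ℤ._* (ℤ.suc N ℤ.- + suc j)) (fallingℤ-shift N j) ⟩
  ℤ.suc N ℤ.* fallingℤ N j ℤ.* (ℤ.suc N ℤ.- + suc j)   ≡⟨ rearrange N (fallingℤ N j) (+ j) ⟩
  ℤ.suc N ℤ.* (fallingℤ N j ℤ.* (N ℤ.- + j))           ∎
  where
  open ≡-Reasoning
  rearrange : ∀ N f j → (+ 1 ℤ.+ N) ℤ.* f ℤ.* ((+ 1 ℤ.+ N) ℤ.- (+ 1 ℤ.+ j)) ≡ (+ 1 ℤ.+ N) ℤ.* (f ℤ.* (N ℤ.- j))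
  rearrange = solve-∀

fallingℤ-pascal : ∀ N j → fallingℤ (ℤ.suc N) (suc j) ≡ fallingℤ N (suc j) ℤ.+ + suc j ℤ.* fallingℤ N j
fallingℤ-pascal N j = ≡.trans (fallingℤ-shift N j) (split N (fallingℤ N j) (+ j))
  where
  split : ∀ N f j → (+ 1 ℤ.+ N) ℤ.* f ≡ f ℤ.* (N ℤ.- j) ℤ.+ (+ 1 ℤ.+ j) ℤ.* f
  split = solve-∀

fallingℤ-zero : ∀ j → fallingℤ (+ 0) (suc j) ≡ + 0
fallingℤ-zero j = fallingℤ-shift -[1+ 0 ] j

fallingℤ≡choose*! : ∀ j N → fallingℤ N j ≡ choose N j ℤ.* + (j !)
fallingℤ≡choose*! zero    N = ≡.refl
fallingℤ≡choose*! (suc j)   =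
  equal-increments⇒≈ (AbelianGroup.group ℤₚ.+-0-abelianGroup)
    (λ N → fallingℤ N (suc j)) (λ N → choose N (suc j) ℤ.* + (suc j !)) (λ N → + suc j ℤ.* fallingℤ N j)
    (λ N → fallingℤ-pascal N j) choose-step (fallingℤ-zero j)
  where
  s! : ℤ
  s! = + (suc j !)

  choose-step : ∀ N → choose (ℤ.suc N) (suc j) ℤ.* s! ≡ choose N (suc j) ℤ.* s! ℤ.+ + suc j ℤ.* fallingℤ N j
  choose-step N = begin
    choose (ℤ.suc N) (suc j) ℤ.* s!           ≡⟨ ≡.cong (ℤ._* s!) (choose-pascal N j) ⟩
    (a ℤ.+ b) ℤ.* s!                          ≡⟨ ≡.cong ((a ℤ.+ b) ℤ.*_) (ℤₚ.pos-* (suc j) (j !)) ⟩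
    (a ℤ.+ b) ℤ.* (+ suc j ℤ.* + (j !))       ≡⟨ distrib a b (+ suc j) (+ (j !)) ⟩
    a ℤ.* (+ suc j ℤ.* + (j !)) ℤ.+ + suc j ℤ.* (b ℤ.* + (j !))
      ≡⟨ ≡.cong₂ (λ u v → a ℤ.* u ℤ.+ + suc j ℤ.* v) (ℤₚ.pos-* (suc j) (j !)) (fallingℤ≡choose*! j N) ⟨
    a ℤ.* s! ℤ.+ + suc j ℤ.* fallingℤ N j     ∎
    where
    open ≡-Reasoning
    a b : ℤ
    a = choose N (suc j)
    b = choose N j
    distrib : ∀ a b s f → (a ℤ.+ b) ℤ.* (s ℤ.* f) ≡ a ℤ.* (s ℤ.* f) ℤ.+ s ℤ.* (b ℤ.* f)
    distrib = solve-∀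

i*n/ℕn≡i : ∀ i n .{{_ : NonZero n}} → (i ℤ.* + n) ℤ./ℕ n ≡ i
i*n/ℕn≡i (+ k) (suc n) rewrite ≡.sym (ℤₚ.pos-* k (suc n)) = ≡.cong +_ (m*n/n≡m k (suc n))
-- On a negative dividend _/ℕ_ branches on the remainder, which vanishes here.
i*n/ℕn≡i -[1+ k ] (suc n) with suc (n ℕ.+ k ℕ.* suc n) ℕ.% suc n | m*n%n≡0 (suc k) (suc n)
... | .0 | ≡.refl = ≡.cong (λ z → ℤ.- (+ z)) (m*n/n≡m (suc k) (suc n))

binomℤ≡choose : ∀ N j → binomℤ N j ≡ choose N j
binomℤ≡choose N j = ≡.trans (≡.cong (λ z → ℤ._/ℕ_ z (j !) {{j ℕₚ.!≢0}}) (fallingℤ≡choose*! j N)) (i*n/ℕn≡i (choose N j) (j !) {{j ℕₚ.!≢0}})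

[1+M]-m+1≡1+[M-m+1] : ∀ m M → + 1 ℤ.+ M ℤ.- m ℤ.+ + 1 ≡ + 1 ℤ.+ (M ℤ.- m ℤ.+ + 1)
[1+M]-m+1≡1+[M-m+1] = solve-∀

module _ {c ℓ : Level} (R : CommutativeRing c ℓ) where
  open CommutativeRing R
  open import Algebra.Properties.Ring ring using (-0#≈0#; -‿+-comm; xyx⁻¹≈y; x[y-z]≈xy-xz; [y-z]x≈yx-zx)
  open import Algebra.Properties.CommutativeSemigroup +-commutativeSemigroup using (interchange)
  open import Relation.Binary.Reasoning.Setoid setoid

  [1+a]-[1+b]≈a-b : ∀ a b → (1# + a) - (1# + b) ≈ a - b
  [1+a]-[1+b]≈a-b a b = begin
    (1# + a) + - (1# + b)    ≈⟨ +-congˡ (-‿+-comm 1# b) ⟨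
    (1# + a) + (- 1# + - b)  ≈⟨ interchange 1# a (- 1#) (- b) ⟩
    (1# - 1#) + (a - b)      ≈⟨ +-congʳ (-‿inverseʳ 1#) ⟩
    0# + (a - b)             ≈⟨ +-identityˡ (a - b) ⟩
    a - b                    ∎

  -[a+b]+a≈-b : ∀ a b → - (a + b) + a ≈ - b
  -[a+b]+a≈-b a b = begin
    - (a + b) + a      ≈⟨ +-congʳ (-‿+-comm a b) ⟨
    - a + - b + a      ≈⟨ +-congʳ (+-comm (- a) (- b)) ⟩
    - b + - a + a      ≈⟨ +-assoc (- b) (- a) a ⟩
    - b + (- a + a)    ≈⟨ +-congˡ (-‿inverseˡ a) ⟩
    - b + 0#           ≈⟨ +-identityʳ (- b) ⟩
    - b                ∎

  [a+tb]-[c+td]≈[a-c]+t[b-d] : ∀ a b c d t → (a + t * b) - (c + t * d) ≈ (a - c) + t * (b - d)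
  [a+tb]-[c+td]≈[a-c]+t[b-d] a b c d t = begin
    (a + t * b) - (c + t * d)         ≈⟨ +-congˡ (-‿+-comm c (t * d)) ⟨
    (a + t * b) + (- c + - (t * d))   ≈⟨ interchange a (t * b) (- c) (- (t * d)) ⟩
    (a - c) + (t * b - t * d)         ≈⟨ +-congˡ (x[y-z]≈xy-xz t b d) ⟨
    (a - c) + t * (b - d)             ∎

  natR-+ : ∀ m n → natR R (m ℕ.+ n) ≈ natR R m + natR R n
  natR-+ zero    n = sym (+-identityˡ (natR R n))
  natR-+ (suc m) n = trans (+-congˡ (natR-+ m n)) (sym (+-assoc 1# (natR R m) (natR R n)))

  fromℤ-⊖ : ∀ m n → fromℤ R (m ℤ.⊖ n) ≈ natR R m - natR R n
  fromℤ-⊖ m       zero    = sym (trans (+-congˡ -0#≈0#) (+-identityʳ (natR R m)))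
  fromℤ-⊖ zero    (suc n) = sym (+-identityˡ (- natR R (suc n)))
  fromℤ-⊖ (suc m) (suc n) = begin
    fromℤ R (suc m ℤ.⊖ suc n)   ≡⟨ ≡.cong (fromℤ R) (ℤₚ.[1+m]⊖[1+n]≡m⊖n m n) ⟩
    fromℤ R (m ℤ.⊖ n)           ≈⟨ fromℤ-⊖ m n ⟩
    natR R m - natR R n         ≈⟨ [1+a]-[1+b]≈a-b (natR R m) (natR R n) ⟨
    natR R (suc m) - natR R (suc n) ∎

  fromℤ-+ : ∀ i j → fromℤ R (i ℤ.+ j) ≈ fromℤ R i + fromℤ R j
  fromℤ-+ (+ m)    (+ n)    = natR-+ m n
  fromℤ-+ (+ m)    -[1+ n ] = fromℤ-⊖ m (suc n)
  fromℤ-+ -[1+ m ] (+ n)    = trans (fromℤ-⊖ n (suc m)) (+-comm (natR R n) _)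
  fromℤ-+ -[1+ m ] -[1+ n ] = begin
    - natR R (suc (suc (m ℕ.+ n)))      ≡⟨ ≡.cong (λ k → - natR R (suc k)) (ℕₚ.+-suc m n) ⟨
    - natR R (suc m ℕ.+ suc n)          ≈⟨ -‿cong (natR-+ (suc m) (suc n)) ⟩
    - (natR R (suc m) + natR R (suc n)) ≈⟨ -‿+-comm _ _ ⟨
    - natR R (suc m) + - natR R (suc n) ∎

  sumFrom-suc : ∀ m k (h : ℤ → Carrier) → sumFrom R m (suc k) h ≈ sumFrom R m k h + h (m ℤ.+ + k)
  sumFrom-suc m zero    h = begin
    h m + 0#            ≈⟨ +-comm (h m) 0# ⟩
    0# + h m            ≡⟨ ≡.cong (λ i → 0# + h i) (ℤₚ.+-identityʳ m) ⟨
    0# + h (m ℤ.+ + 0)  ∎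
  sumFrom-suc m (suc k) h = begin
    h m + sumFrom R (m ℤ.+ + 1) (suc k) h                         ≈⟨ +-congˡ (sumFrom-suc (m ℤ.+ + 1) k h) ⟩
    h m + (sumFrom R (m ℤ.+ + 1) k h + h (m ℤ.+ + 1 ℤ.+ + k))     ≈⟨ +-assoc (h m) _ _ ⟨
    h m + sumFrom R (m ℤ.+ + 1) k h + h (m ℤ.+ + 1 ℤ.+ + k)       ≡⟨ ≡.cong (λ i → h m + sumFrom R (m ℤ.+ + 1) k h + h i) (ℤₚ.+-assoc m (+ 1) (+ k)) ⟩
    h m + sumFrom R (m ℤ.+ + 1) k h + h (m ℤ.+ + suc k)           ∎

  gsum-nonneg : ∀ m M k h → M ℤ.- m ℤ.+ + 1 ≡ + k → gsum R m M h ≡ sumFrom R m k h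
  gsum-nonneg m M k h eq with M ℤ.- m ℤ.+ + 1
  gsum-nonneg m M k h ≡.refl | .(+ k) = ≡.refl

  gsum-neg : ∀ m M k h → M ℤ.- m ℤ.+ + 1 ≡ -[1+ k ] → gsum R m M h ≡ - sumFrom R (M ℤ.+ + 1) (suc k) h
  gsum-neg m M k h eq with M ℤ.- m ℤ.+ + 1
  gsum-neg m M k h ≡.refl | .(-[1+ k ]) = ≡.refl

  gsum-suc : ∀ m M h → gsum R m (ℤ.suc M) h ≈ gsum R m M h + h (ℤ.suc M)
  gsum-suc m M h with M ℤ.- m ℤ.+ + 1 in eq
  ... | + k = begin
    gsum R m (ℤ.suc M) h        ≡⟨ gsum-nonneg m (ℤ.suc M) (suc k) h (≡.trans ([1+M]-m+1≡1+[M-m+1] m M) (≡.cong ℤ.suc eq)) ⟩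
    sumFrom R m (suc k) h       ≈⟨ sumFrom-suc m k h ⟩
    sumFrom R m k h + h (m ℤ.+ + k) ≡⟨ ≡.cong (λ i → sumFrom R m k h + h i) (≡.trans (≡.cong (ℤ._+_ m) (≡.sym eq)) (upper m M)) ⟩
    sumFrom R m k h + h (ℤ.suc M) ∎
    where
    upper : ∀ m M → m ℤ.+ (M ℤ.- m ℤ.+ + 1) ≡ + 1 ℤ.+ M
    upper = solve-∀
  ... | -[1+ zero ] = begin
    gsum R m (ℤ.suc M) h                      ≡⟨ gsum-nonneg m (ℤ.suc M) 0 h (≡.trans ([1+M]-m+1≡1+[M-m+1] m M) (≡.cong ℤ.suc eq)) ⟩
    0#                                        ≈⟨ -0#≈0# ⟨
    - 0#                                      ≈⟨ -[a+b]+a≈-b (h (ℤ.suc M)) 0# ⟨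
    - (h (ℤ.suc M) + 0#) + h (ℤ.suc M)        ≡⟨ ≡.cong (λ i → - (h i + 0#) + h (ℤ.suc M)) (ℤₚ.+-comm M (+ 1)) ⟨
    - (h (M ℤ.+ + 1) + 0#) + h (ℤ.suc M)      ∎
  ... | -[1+ suc k ] = begin
    gsum R m (ℤ.suc M) h                      ≡⟨ gsum-neg m (ℤ.suc M) k h (≡.trans ([1+M]-m+1≡1+[M-m+1] m M) (≡.cong ℤ.suc eq)) ⟩
    - S                                       ≈⟨ -[a+b]+a≈-b (h (ℤ.suc M)) S ⟨
    - (h (ℤ.suc M) + S) + h (ℤ.suc M)         ≡⟨ ≡.cong (λ i → - (h i + sumFrom R (i ℤ.+ + 1) (suc k) h) + h (ℤ.suc M)) (ℤₚ.+-comm M (+ 1)) ⟨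
    - (h (M ℤ.+ + 1) + sumFrom R (M ℤ.+ + 1 ℤ.+ + 1) (suc k) h) + h (ℤ.suc M) ∎
    where
    S : Carrier
    S = sumFrom R (ℤ.suc M ℤ.+ + 1) (suc k) h

  sumBelow-cong : ∀ n {f g : ℕ → Carrier} → (∀ j → f j ≈ g j) → sumBelow R n f ≈ sumBelow R n g
  sumBelow-cong zero    f≈g = refl
  sumBelow-cong (suc n) f≈g = +-cong (sumBelow-cong n f≈g) (f≈g n)

  sumBelow-+ : ∀ n (f g : ℕ → Carrier) → sumBelow R n (λ j → f j + g j) ≈ sumBelow R n f + sumBelow R n g
  sumBelow-+ zero    f g = sym (+-identityˡ 0#)
  sumBelow-+ (suc n) f g = trans (+-congʳ (sumBelow-+ n f g)) (interchange _ _ (f n) (g n))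

  sumBelow-*ˡ : ∀ n a (f : ℕ → Carrier) → sumBelow R n (λ j → a * f j) ≈ a * sumBelow R n f
  sumBelow-*ˡ zero    a f = sym (zeroʳ a)
  sumBelow-*ˡ (suc n) a f = trans (+-congʳ (sumBelow-*ˡ n a f)) (sym (distribˡ a _ (f n)))

  sumBelow-suc : ∀ n (f : ℕ → Carrier) → sumBelow R (suc n) f ≈ f 0 + sumBelow R n (λ j → f (suc j))
  sumBelow-suc zero    f = +-comm 0# (f 0)
  sumBelow-suc (suc n) f = trans (+-congʳ (sumBelow-suc n f)) (+-assoc (f 0) _ (f (suc n)))

  module _ (x y : Carrier) (x*y≈1 : x * y ≈ 1#) where
    t : Carrier
    t = (x - 1#) * y

    zpow-suc : ∀ b → zpow R x y (ℤ.suc b) ≈ x * zpow R x y b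
    zpow-suc (+ k)          = refl
    zpow-suc -[1+ zero ]    = sym (trans (*-congˡ (*-identityʳ y)) x*y≈1)
    zpow-suc -[1+ suc k ]   = begin
      pow R y (suc k)             ≈⟨ *-identityˡ _ ⟨
      1# * pow R y (suc k)        ≈⟨ *-congʳ x*y≈1 ⟨
      x * y * pow R y (suc k)     ≈⟨ *-assoc x y _ ⟩
      x * pow R y (suc (suc k))   ∎

    t*x≈x-1 : t * x ≈ x - 1#
    t*x≈x-1 = begin
      (x - 1#) * y * x     ≈⟨ *-assoc (x - 1#) y x ⟩
      (x - 1#) * (y * x)   ≈⟨ *-congˡ (trans (*-comm y x) x*y≈1) ⟩
      (x - 1#) * 1#        ≈⟨ *-identityʳ (x - 1#) ⟩
      x - 1#               ∎

    zpow-suc≈zpow+t*zpow-suc : ∀ b → zpow R x y (ℤ.suc b) ≈ zpow R x y b + t * zpow R x y (ℤ.suc b)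
    zpow-suc≈zpow+t*zpow-suc b = sym (begin
      z + t * zpow R x y (ℤ.suc b) ≈⟨ +-congˡ (*-congˡ (zpow-suc b)) ⟩
      z + t * (x * z)              ≈⟨ +-congˡ (*-assoc t x z) ⟨
      z + t * x * z                ≈⟨ +-congˡ (*-congʳ t*x≈x-1) ⟩
      z + (x - 1#) * z             ≈⟨ +-congˡ ([y-z]x≈yx-zx z x 1#) ⟩
      z + (x * z - 1# * z)         ≈⟨ +-congˡ (+-congˡ (-‿cong (*-identityˡ z))) ⟩
      z + (x * z - z)              ≈⟨ +-assoc z (x * z) (- z) ⟨
      z + x * z - z                ≈⟨ xyx⁻¹≈y z (x * z) ⟩
      x * z                        ≈⟨ zpow-suc b ⟨
      zpow R x y (ℤ.suc b)         ∎)
      where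
      z : Carrier
      z = zpow R x y b

    coeff : ℤ → ℕ → Carrier
    coeff a j = fromℤ R (binomℤ (a ℤ.+ + j ℤ.- + 1) j)

    term : ℤ → ℕ → Carrier
    term a j = pow R t j * coeff a j

    closedForm : ℕ → ℤ → Carrier
    closedForm n a = zpow R x y a - sumBelow R n (term a)

    coeff≈choose : ∀ a j {N} → a ℤ.+ + j ℤ.- + 1 ≡ N → coeff a j ≈ fromℤ R (choose N j)
    coeff≈choose a j eq = reflexive (≡.cong (fromℤ R) (≡.trans (binomℤ≡choose _ j) (≡.cong (λ M → choose M j) eq)))

    coeff-zero : ∀ a → coeff a 0 ≈ 1#
    coeff-zero a = +-identityʳ 1#

    coeff-origin : ∀ j → coeff (+ 0) (suc j) ≈ 0#
    coeff-origin j = trans (coeff≈choose (+ 0) (suc j) ≡.refl) (reflexive (≡.cong (fromℤ R) (choose-vanishes (ℕₚ.≤-refl {j}))))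

    coeff-pascal : ∀ b j → coeff (ℤ.suc b) (suc j) ≈ coeff b (suc j) + coeff (ℤ.suc b) j
    coeff-pascal b j = begin
      coeff (ℤ.suc b) (suc j)                        ≈⟨ coeff≈choose (ℤ.suc b) (suc j) (e₁ b (+ j)) ⟩
      fromℤ R (choose (ℤ.suc N) (suc j))             ≡⟨ ≡.cong (fromℤ R) (choose-pascal N j) ⟩
      fromℤ R (choose N (suc j) ℤ.+ choose N j)      ≈⟨ fromℤ-+ (choose N (suc j)) (choose N j) ⟩
      fromℤ R (choose N (suc j)) + fromℤ R (choose N j)
        ≈⟨ +-cong (coeff≈choose b (suc j) (e₂ b (+ j))) (coeff≈choose (ℤ.suc b) j (e₃ b (+ j))) ⟨
      coeff b (suc j) + coeff (ℤ.suc b) j            ∎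
      where
      N : ℤ
      N = b ℤ.+ + j
      e₁ : ∀ b j → + 1 ℤ.+ b ℤ.+ (+ 1 ℤ.+ j) ℤ.- + 1 ≡ + 1 ℤ.+ (b ℤ.+ j)
      e₁ = solve-∀
      e₂ : ∀ b j → b ℤ.+ (+ 1 ℤ.+ j) ℤ.- + 1 ≡ b ℤ.+ j
      e₂ = solve-∀
      e₃ : ∀ b j → + 1 ℤ.+ b ℤ.+ j ℤ.- + 1 ≡ b ℤ.+ j
      e₃ = solve-∀

    term-pascal : ∀ b j → term (ℤ.suc b) (suc j) ≈ term b (suc j) + t * term (ℤ.suc b) j
    term-pascal b j = begin
      pow R t (suc j) * coeff (ℤ.suc b) (suc j)                          ≈⟨ *-congˡ (coeff-pascal b j) ⟩
      pow R t (suc j) * (coeff b (suc j) + coeff (ℤ.suc b) j)            ≈⟨ distribˡ (pow R t (suc j)) _ _ ⟩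
      pow R t (suc j) * coeff b (suc j) + t * pow R t j * coeff (ℤ.suc b) j ≈⟨ +-congˡ (*-assoc t (pow R t j) _) ⟩
      term b (suc j) + t * term (ℤ.suc b) j                              ∎

    sumBelow-term-suc : ∀ n b →
      sumBelow R (suc n) (term (ℤ.suc b)) ≈ sumBelow R (suc n) (term b) + t * sumBelow R n (term (ℤ.suc b))
    sumBelow-term-suc n b = begin
      sumBelow R (suc n) (term (ℤ.suc b))                           ≈⟨ sumBelow-suc n (term (ℤ.suc b)) ⟩
      term (ℤ.suc b) 0 + sumBelow R n (λ j → term (ℤ.suc b) (suc j))
        ≈⟨ +-cong (*-congˡ (trans (coeff-zero (ℤ.suc b)) (sym (coeff-zero b)))) (sumBelow-cong n (term-pascal b)) ⟩
      term b 0 + sumBelow R n (λ j → term b (suc j) + t * term (ℤ.suc b) j)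
        ≈⟨ +-congˡ (trans (sumBelow-+ n _ _) (+-congˡ (sumBelow-*ˡ n t (term (ℤ.suc b))))) ⟩
      term b 0 + (sumBelow R n (λ j → term b (suc j)) + t * Σ)     ≈⟨ +-assoc (term b 0) _ _ ⟨
      term b 0 + sumBelow R n (λ j → term b (suc j)) + t * Σ       ≈⟨ +-congʳ (sumBelow-suc n (term b)) ⟨
      sumBelow R (suc n) (term b) + t * Σ                           ∎
      where
      Σ : Carrier
      Σ = sumBelow R n (term (ℤ.suc b))

    closedForm-suc : ∀ n b → closedForm (suc n) (ℤ.suc b) ≈ closedForm (suc n) b + t * closedForm n (ℤ.suc b)
    closedForm-suc n b = trans
      (+-cong (zpow-suc≈zpow+t*zpow-suc b) (-‿cong (sumBelow-term-suc n b)))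
      ([a+tb]-[c+td]≈[a-c]+t[b-d] _ _ _ _ t)

    sumBelow-term-origin : ∀ n → sumBelow R (suc n) (term (+ 0)) ≈ 1#
    sumBelow-term-origin zero    = trans (+-identityˡ _) (trans (*-identityˡ _) (coeff-zero (+ 0)))
    sumBelow-term-origin (suc n) = trans
      (+-cong (sumBelow-term-origin n) (trans (*-congˡ (coeff-origin n)) (zeroʳ _)))
      (+-identityʳ 1#)

    closedForm-origin : ∀ n → closedForm (suc n) (+ 0) ≈ 0#
    closedForm-origin n = trans (+-congˡ (-‿cong (sumBelow-term-origin n))) (-‿inverseʳ 1#)

    iterSum-suc : ∀ n b → iterSum R x y (suc n) (ℤ.suc b) ≈ iterSum R x y (suc n) b + iterSum R x y n (ℤ.suc b)
    iterSum-suc n b = gsum-suc (+ 1) b (iterSum R x y n)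

    scaled-iterSum≈closedForm : ∀ n a → pow R t n * iterSum R x y n a ≈ closedForm n a
    scaled-iterSum≈closedForm zero    a = trans (*-identityˡ _) (sym (trans (+-congˡ -0#≈0#) (+-identityʳ _)))
    scaled-iterSum≈closedForm (suc n)   =
      equal-increments⇒≈ +-group (λ a → pow R t (suc n) * iterSum R x y (suc n) a) (closedForm (suc n))
        (λ b → t * closedForm n (ℤ.suc b)) scaled-step (closedForm-suc n)
        (trans (zeroʳ _) (sym (closedForm-origin n)))
      where
      scaled-step : ∀ b → pow R t (suc n) * iterSum R x y (suc n) (ℤ.suc b)
                          ≈ pow R t (suc n) * iterSum R x y (suc n) b + t * closedForm n (ℤ.suc b)
      scaled-step b = trans (*-congˡ (iterSum-suc n b)) (trans (distribˡ _ _ _)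
        (+-congˡ (trans (*-assoc t (pow R t n) _) (*-congˡ (scaled-iterSum≈closedForm n (ℤ.suc b))))))

-- The identity holds for n = 0 as well.
lemma2 : {c ℓ : Level} (R : CommutativeRing c ℓ) →
    let open CommutativeRing R in
    (x y : Carrier) → x * y ≈ 1# →
    (n : ℕ) → .{{NonZero n}} → (a : ℤ) →
    pow R ((x - 1#) * y) n * iterSum R x y n a
      ≈ zpow R x y a - sumBelow R n (λ j → pow R ((x - 1#) * y) j * fromℤ R (binomℤ (a ℤ.+ + j ℤ.- + 1) j))
lemma2 R x y x*y≈1 n a = scaled-iterSum≈closedForm R x y x*y≈1 n a
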